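{- Let $S$ be a string of length $n>1$ as described in the context, and let $\mathcal{G}=\langle g_s,g_e,|\alpha|\rangle$ be a weakly preliminary group of a suffix grouping for $S$. Then there is some $g'\in\{g_s,\dots,g_e-1\}$ such that $\mathcal{G}'=\langle g_s,g',|\alpha|\rangle$ is a Lyndon group and $\mathcal{G}''=\langle g'+1,g_e,|\alpha|\rangle$ is a strongly preliminary group, and replacing $\mathcal{G}$ by $\mathcal{G}'$ and $\mathcal{G}''$ results in a valid suffix grouping.
   Context: $S$ is a string of length $n>1$ over a totally ordered alphabet $\Sigma$, zero-indexed, with $S[n-1]=\$$ and $S[k]>\$$ for all $k<n-1$. $S_i=S[i]\cdots S[n-1]$; $\prec$ is the lexicographic order (a proper prefix is smaller). A non-empty string is a Lyndon word if it is lexicographically smaller than all its proper suffixes; $\mathcal{L}_i$ is the longest prefix of $S_i$ that is a Lyndon word. The suffix array $\mathrm{SA}$ is the permutation of $\{0,\dots,n-1\}$ with $S_{\mathrm{SA}[0]}\prec\cdots\prec S_{\mathrm{SA}[n-1]}$. A group with context $\alpha$ is a triple $\langle g_s,g_e,|\alpha|\rangle$ with $0\le g_s\le g_e<n$ such that $\alpha$ is a Lyndon word and every $i\in\{\mathrm{SA}[g_s],\dots,\mathrm{SA}[g_e]\}$ (the elements of the group) satisfies $S_i=\alpha S_{i+|\alpha|}$. A suffix grouping is a set of groups $\langle g_{s,j},g_{e,j},|\alpha_j|\rangle$, $j=1,\dots,m$, with $g_{s,1}=0$, $g_{e,m}=n-1$, $g_{s,j}=g_{e,j-1}+1$. A group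 with context $\alpha$ is Lyndon if all its elements $i$ satisfy $\mathcal{L}_i=\alpha$, and preliminary otherwise. A preliminary group is strongly preliminary if none of its elements $i$ satisfies $\mathcal{L}_i=\alpha$, and weakly preliminary otherwise (i.e. some but not all elements have Lyndon prefix $\alpha$). -}

module Defs where

open import Data.Nat using (ℕ; zero; suc; _+_; _∸_; _≤_; _<_)
open import Data.List using (List; []; _∷_; _++_; length; drop; [_])
open import Data.List.Relation.Unary.All using (All)
open import Data.Product using (Σ; ∃; _×_; _,_)
open import Relation.Binary.PropositionalEquality using (_≡_; _≢_)
open import Relation.Nullary using (¬_)

module Str {A : Set} (_<ₐ_ : A → A → Set) where

  data _≺_ : List A → List A → Set where
    halt : ∀ {y ys} → [] ≺ (y ∷ ys)
    this : ∀ {x y xs ys} → x <ₐ y → (x ∷ xs) ≺ (y ∷ ys)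
    next : ∀ {x xs ys} → xs ≺ ys → (x ∷ xs) ≺ (x ∷ ys)

  Lyndon : List A → Set
  Lyndon w = (w ≢ []) × (∀ k → 0 < k → k < length w → w ≺ drop k w)

  IsPrefix : List A → List A → Set
  IsPrefix u s = ∃ λ r → s ≡ u ++ r

  LongestLyndonPrefix : List A → List A → Set
  LongestLyndonPrefix α s =
    IsPrefix α s × Lyndon α × (∀ β → IsPrefix β s → Lyndon β → length β ≤ length α)

  -- S[n-1] = $ and S[k] > $ for k < n-1, with n > 1.
  WellFormed : List A → Set
  WellFormed S = 1 < length S × ∃ λ T → ∃ λ d → S ≡ T ++ [ d ] × All (d <ₐ_) T

  module OnString (S : List A) where

    n : ℕ
    n = length S

    suf : ℕ → List A
    suf i = drop i S

    IsSuffixArray : (ℕ → ℕ) → Set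
    IsSuffixArray SA =
      (∀ k → k < n → SA k < n) ×
      (∀ i → i < n → ∃ λ k → k < n × SA k ≡ i) ×
      (∀ j k → j < k → k < n → suf (SA j) ≺ suf (SA k))

    module WithSA (SA : ℕ → ℕ) where

      Group : ℕ → ℕ → List A → Set
      Group gs ge α = gs ≤ ge × ge < n × Lyndon α ×
        (∀ k → gs ≤ k → k ≤ ge → suf (SA k) ≡ α ++ suf (SA k + length α))

      AllLyn : ℕ → ℕ → List A → Set
      AllLyn gs ge α = ∀ k → gs ≤ k → k ≤ ge → LongestLyndonPrefix α (suf (SA k))

      LyndonGroup : ℕ → ℕ → List A → Set
      LyndonGroup gs ge α = Group gs ge α × AllLyn gs ge α

      PreliminaryGroup : ℕ → ℕ → List A → Set
      PreliminaryGroup gs ge α = Group gs ge α × ¬ AllLyn gs ge α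

      StronglyPreliminary : ℕ → ℕ → List A → Set
      StronglyPreliminary gs ge α = PreliminaryGroup gs ge α ×
        (∀ k → gs ≤ k → k ≤ ge → ¬ LongestLyndonPrefix α (suf (SA k)))

      WeaklyPreliminary : ℕ → ℕ → List A → Set
      WeaklyPreliminary gs ge α = PreliminaryGroup gs ge α ×
        (∃ λ k → gs ≤ k × k ≤ ge × LongestLyndonPrefix α (suf (SA k)))

      -- A group given as a triple ⟨gs, ge, ℓ⟩ (ℓ = |α|).
      Triple : Set
      Triple = ℕ × ℕ × ℕ

      IsGroupTriple : Triple → Set
      IsGroupTriple (gs , ge , ℓ) = ∃ λ α → length α ≡ ℓ × Group gs ge α

      Tiles : ℕ → List Triple → Set
      Tiles p [] = p ≡ n
      Tiles p ((gs , ge , ℓ) ∷ rest) = gs ≡ p × Tiles (suc ge) rest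

      SuffixGrouping : List Triple → Set
      SuffixGrouping G = (G ≢ []) × Tiles 0 G × All IsGroupTriple G

{-# OPTIONS --safe #-}
-- Within a group with context α the suffixes are sorted, and having α as longest
-- Lyndon prefix is inherited by lexicographically smaller suffixes that start with α:
-- if αu ≺ αv and αu had a Lyndon prefix αγ longer than α, then either γ is a prefix
-- of v, or γ and v first differ at a letter that is larger in v, and raising that last
-- letter of a Lyndon prefix keeps it Lyndon; either way αv would have a Lyndon prefix
-- longer than α. So the elements with Lyndon prefix α form an initial segment of the
-- group, which is proper and non-empty since the group is weakly preliminary.
module Submission where

open import Defs
open import Data.Nat using (ℕ; zero; suc; _+_; _≤_; _<_; s≤s; z<s; _≤?_; _<?_)
open import Data.Nat.Properties
  using (≤-refl; ≤-trans; ≤-<-trans; <⇒≤; <⇒≱; ≰⇒>; ≤∧≢⇒<; m<1+n⇒m≤n;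
         m<n⇒m<1+n; n≤1+n; m≤m+n; m<m+n; m≤n⇒m<n∨m≡n; m≤n⇒m⊓n≡m; ∸-monoʳ-<; +-comm; allUpTo?)
open import Data.List using (List; []; _∷_; _++_; length; take; drop; [_])
open import Data.List.Properties
  using (length-++; ++-assoc; length-take; length-drop; take++drop≡id; ∷-injective; ∷-injectiveʳ;
         ++-conicalʳ)
open import Data.List.Relation.Unary.All using (_∷_)
open import Data.List.Relation.Unary.All.Properties using (++⁺; ++⁻)
open import Data.Product using (∃; _×_; _,_)
open import Data.Sum using (_⊎_; inj₁; inj₂)
open import Relation.Nullary using (¬_; Dec; yes; no; contradiction)
open import Relation.Nullary.Decidable using (map′; _→-dec_)
open import Relation.Unary using (Pred; Decidable)
open import Relation.Binary.PropositionalEquality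
  using (_≡_; _≢_; refl; sym; trans; cong; subst; subst₂)
open import Relation.Binary.Structures using (IsStrictTotalOrder)
open import Relation.Binary.Definitions using (tri<; tri≈; tri>)

module _ {A : Set} where

  take-length-++ : ∀ (xs ys : List A) → take (length xs) (xs ++ ys) ≡ xs
  take-length-++ []       ys = refl
  take-length-++ (x ∷ xs) ys = cong (x ∷_) (take-length-++ xs ys)

  drop-++ : ∀ k (xs ys : List A) → k ≤ length xs → drop k (xs ++ ys) ≡ drop k xs ++ ys
  drop-++ zero    xs       ys _         = refl
  drop-++ (suc k) (x ∷ xs) ys (s≤s k≤n) = drop-++ k xs ys k≤n

  ++-split-longer : ∀ (α β r u : List A) → β ++ r ≡ α ++ u → length α ≤ length β →
                    ∃ λ γ → β ≡ α ++ γ × u ≡ γ ++ r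
  ++-split-longer []      β       r u eq _ = β , refl , sym eq
  ++-split-longer (a ∷ α) (b ∷ β) r u eq (s≤s α≤β) with ∷-injective eq
  ... | refl , eq′ with ++-split-longer α β r u eq′ α≤β
  ...   | γ , refl , refl = γ , refl , refl

module _ {p} {P : Pred ℕ p} (P? : Decidable P) where

  last-true : ∀ {a b} → a < b → P a → ¬ P b → ∃ λ g → a ≤ g × g < b × P g × ¬ P (suc g)
  last-true {a} {suc b} (s≤s a≤b) pa ¬p1+b with P? b
  ... | yes pb = b , a≤b , ≤-refl , pb , ¬p1+b
  ... | no ¬pb with last-true (≤∧≢⇒< a≤b λ { refl → ¬pb pa }) pa ¬pb
  ...   | g , a≤g , g<b , pg , ¬p1+g = g , a≤g , m<n⇒m<1+n g<b , pg , ¬p1+g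

  antitone-threshold : ∀ {a b} → (∀ {j k} → a ≤ j → j ≤ k → k ≤ b → P k → P j) →
    (∃ λ w → a ≤ w × w ≤ b × P w) → ¬ (∀ k → a ≤ k → k ≤ b → P k) →
    ∃ λ g → a ≤ g × g < b × (∀ k → a ≤ k → k ≤ g → P k) × (∀ k → suc g ≤ k → k ≤ b → ¬ P k)
  antitone-threshold {a} {b} antitone (w , a≤w , w≤b , pw) ¬all
    with last-true (≤∧≢⇒< (≤-trans a≤w w≤b) λ { refl → ¬pb pa }) pa ¬pb
    where
    pa : P a
    pa = antitone ≤-refl a≤w w≤b pw
    ¬pb : ¬ P b
    ¬pb pb = ¬all λ k a≤k k≤b → antitone a≤k k≤b ≤-refl pb
  ... | g , a≤g , g<b , pg , ¬p1+g =
    g , a≤g , g<b , (λ k a≤k k≤g → antitone a≤k k≤g (<⇒≤ g<b) pg) ,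
    (λ k 1+g≤k k≤b pk → ¬p1+g (antitone (≤-trans a≤g (n≤1+n g)) 1+g≤k k≤b pk))

module LyndonPrefixes {A : Set} (_<ₐ_ : A → A → Set) (sto : IsStrictTotalOrder _≡_ _<ₐ_) where
  open Str _<ₐ_
  open IsStrictTotalOrder sto using (compare; _≟_; irrefl) renaming (trans to <ₐ-trans)

  ≺-cancelˡ : ∀ α {u v} → (α ++ u) ≺ (α ++ v) → u ≺ v
  ≺-cancelˡ []      αu≺αv    = αu≺αv
  ≺-cancelˡ (a ∷ α) (this a<a) = contradiction a<a (irrefl refl)
  ≺-cancelˡ (a ∷ α) (next p)   = ≺-cancelˡ α p

  Diverges : List A → List A → Set
  Diverges γ v = ∃ λ w → ∃ λ d → ∃ λ e → ∃ λ r₁ → ∃ λ r₂ →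
                 γ ≡ w ++ d ∷ r₁ × v ≡ w ++ e ∷ r₂ × d <ₐ e

  prefix-or-diverges : ∀ γ {r v} → (γ ++ r) ≺ v → IsPrefix γ v ⊎ Diverges γ v
  prefix-or-diverges []      {v = v}     _          = inj₁ (v , refl)
  prefix-or-diverges (g ∷ γ) {v = y ∷ v} (this g<y) = inj₂ ([] , g , y , γ , v , refl , refl , g<y)
  prefix-or-diverges (g ∷ γ)             (next p) with prefix-or-diverges γ p
  ... | inj₁ (r , refl)                          = inj₁ (r , refl)
  ... | inj₂ (w , d , e , r₁ , r₂ , refl , refl , d<e) = inj₂ (g ∷ w , d , e , r₁ , r₂ , refl , refl , d<e)

  -- As |T| < |W|, the comparison is decided no later than the position of d in T ++ d ∷ R.
  ≺-raise-last : ∀ W T {d R e} → length T < length W → (W ++ d ∷ R) ≺ (T ++ d ∷ R) → d <ₐ e →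
                 (W ++ [ e ]) ≺ (T ++ [ e ])
  ≺-raise-last (w ∷ W) []      _         (this w<d) d<e = this (<ₐ-trans w<d d<e)
  ≺-raise-last (w ∷ W) []      _         (next _)   d<e = this d<e
  ≺-raise-last (w ∷ W) (t ∷ T) _         (this w<t) d<e = this w<t
  ≺-raise-last (w ∷ W) (t ∷ T) (s≤s T<W) (next p)   d<e = next (≺-raise-last W T T<W p d<e)

  lyndon-raise-last : ∀ W {d R e} → Lyndon (W ++ d ∷ R) → d <ₐ e → Lyndon (W ++ [ e ])
  lyndon-raise-last W {d} {R} {e} (_ , smaller) d<e = nonEmpty , smallerThanSuffix
    where
    nonEmpty : W ++ [ e ] ≢ []
    nonEmpty eq = contradiction (++-conicalʳ W [ e ] eq) λ ()

    smallerThanSuffix : ∀ k → 0 < k → k < length (W ++ [ e ]) → (W ++ [ e ]) ≺ drop k (W ++ [ e ])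
    smallerThanSuffix k 0<k k<|We| =
      subst ((W ++ [ e ]) ≺_) (sym (drop-++ k W [ e ] k≤|W|))
        (≺-raise-last W (drop k W) |drop-k-W|<|W|
          (subst ((W ++ d ∷ R) ≺_) (drop-++ k W (d ∷ R) k≤|W|) (smaller k 0<k k<|WdR|)) d<e)
      where
      k≤|W| : k ≤ length W
      k≤|W| = m<1+n⇒m≤n (subst (k <_) (trans (length-++ W) (+-comm (length W) 1)) k<|We|)
      k<|WdR| : k < length (W ++ d ∷ R)
      k<|WdR| = subst (k <_) (sym (length-++ W)) (≤-<-trans k≤|W| (m<m+n (length W) z<s))
      |drop-k-W|<|W| : length (drop k W) < length W
      |drop-k-W|<|W| = subst (_< length W) (sym (length-drop k W)) (∸-monoʳ-< 0<k k≤|W|)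

  longestLyndonPrefix-antitone : ∀ α {u v} → (α ++ u) ≺ (α ++ v) →
                                 LongestLyndonPrefix α (α ++ v) → LongestLyndonPrefix α (α ++ u)
  longestLyndonPrefix-antitone α {u} {v} αu≺αv (_ , lyndon-α , longest) = (u , refl) , lyndon-α , longest′
    where
    longest′ : ∀ β → IsPrefix β (α ++ u) → Lyndon β → length β ≤ length α
    longest′ β (r , eq) lyndon-β with length β ≤? length α
    ... | yes β≤α = β≤α
    ... | no  β≰α with ++-split-longer α β r u (sym eq) (<⇒≤ (≰⇒> β≰α))
    ...   | γ , refl , refl with prefix-or-diverges γ (≺-cancelˡ α αu≺αv)
    ...     | inj₁ (r′ , refl) = contradiction (longest (α ++ γ) (r′ , sym (++-assoc α γ r′)) lyndon-β) β≰α
    ...     | inj₂ (w , d , e , r₁ , r₂ , refl , refl , d<e) =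
      contradiction (longest (αw ++ [ e ]) (r₂ , αwe-prefix) (lyndon-raise-last αw lyndon-αwd d<e))
                    (<⇒≱ α<αwe)
      where
      αw : List A
      αw = α ++ w
      lyndon-αwd : Lyndon (αw ++ d ∷ r₁)
      lyndon-αwd = subst Lyndon (sym (++-assoc α w (d ∷ r₁))) lyndon-β
      αwe-prefix : α ++ w ++ e ∷ r₂ ≡ (αw ++ [ e ]) ++ r₂
      αwe-prefix = trans (sym (++-assoc α w (e ∷ r₂))) (sym (++-assoc αw [ e ] r₂))
      α<αwe : length α < length (αw ++ [ e ])
      α<αwe = subst (length α <_) (sym (trans (length-++ αw) (cong (_+ 1) (length-++ α))))
                (≤-<-trans (m≤m+n (length α) (length w)) (m<m+n _ z<s))

  _≺?_ : ∀ xs ys → Dec (xs ≺ ys)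
  []       ≺? []       = no λ ()
  []       ≺? (y ∷ ys) = yes halt
  (x ∷ xs) ≺? []       = no λ ()
  (x ∷ xs) ≺? (y ∷ ys) with compare x y
  ... | tri< x<y _ _    = yes (this x<y)
  ... | tri> x≮y x≢y _  = no λ { (this x<y) → x≮y x<y ; (next _) → x≢y refl }
  ... | tri≈ x≮y refl _ = map′ next (λ { (this x<x) → contradiction x<x x≮y ; (next p) → p }) (xs ≺? ys)

  isPrefix? : ∀ u s → Dec (IsPrefix u s)
  isPrefix? []      s       = yes (s , refl)
  isPrefix? (x ∷ u) []      = no λ { (_ , ()) }
  isPrefix? (x ∷ u) (y ∷ s) with x ≟ y
  ... | no  x≢y  = no λ { (_ , refl) → x≢y refl }
  ... | yes refl = map′ (λ (r , eq) → r , cong (x ∷_) eq) (λ (r , eq) → r , ∷-injectiveʳ eq) (isPrefix? u s)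

  lyndon? : ∀ w → Dec (Lyndon w)
  lyndon? []        = no λ (nonEmpty , _) → nonEmpty refl
  lyndon? w@(_ ∷ _) =
    map′ (λ smaller → (λ ()) , λ k 0<k k<|w| → smaller {k} k<|w| 0<k)
         (λ (_ , smaller) {k} k<|w| 0<k → smaller k 0<k k<|w|)
         (allUpTo? (λ k → 0 <? k →-dec w ≺? drop k w) (length w))

  -- Only the prefixes take m s with m ≤ |s| need to be inspected.
  longestLyndonPrefix? : ∀ α s → Dec (LongestLyndonPrefix α s)
  longestLyndonPrefix? α s with isPrefix? α s | lyndon? α
  ... | no ¬prefix | _          = no λ (prefix , _) → ¬prefix prefix
  ... | yes _      | no ¬lyndon = no λ (_ , lyndon , _) → ¬lyndon lyndon
  ... | yes prefix | yes lyndon =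
    map′ (λ (f : Bounded) → prefix , lyndon , longest f) (λ (_ , _ , longest′) → bounded longest′)
         (allUpTo? (λ m → lyndon? (take m s) →-dec m ≤? length α) (suc (length s)))
    where
    Bounded : Set
    Bounded = ∀ {m} → m < suc (length s) → Lyndon (take m s) → m ≤ length α

    longest : Bounded → ∀ β → IsPrefix β s → Lyndon β → length β ≤ length α
    longest f β (r , refl) lyndon-β =
      f (s≤s (subst (length β ≤_) (sym (length-++ β)) (m≤m+n (length β) (length r))))
        (subst Lyndon (sym (take-length-++ β r)) lyndon-β)

    bounded : (∀ β → IsPrefix β s → Lyndon β → length β ≤ length α) → Bounded
    bounded longest′ {m} m<1+|s| lyndon-take =
      subst (_≤ length α) (trans (length-take m s) (m≤n⇒m⊓n≡m (m<1+n⇒m≤n m<1+|s|)))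
        (longest′ (take m s) (drop m s , sym (take++drop≡id m s)) lyndon-take)

module Groups {A : Set} (_<ₐ_ : A → A → Set) (sto : IsStrictTotalOrder _≡_ _<ₐ_)
              (S : List A) (SA : ℕ → ℕ) where
  open Str _<ₐ_
  open OnString S
  open WithSA SA
  open LyndonPrefixes _<ₐ_ sto

  SortsSuffixes : Set
  SortsSuffixes = ∀ j k → j < k → k < n → suf (SA j) ≺ suf (SA k)

  group-restrict : ∀ {gs ge α a b} → Group gs ge α → gs ≤ a → a ≤ b → b ≤ ge → Group a b α
  group-restrict (_ , ge<n , lyndon-α , context) gs≤a a≤b b≤ge =
    a≤b , ≤-<-trans b≤ge ge<n , lyndon-α ,
    λ k a≤k k≤b → context k (≤-trans gs≤a a≤k) (≤-trans k≤b b≤ge)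

  group-lyndonPrefix-antitone : ∀ {gs ge α} → SortsSuffixes → Group gs ge α →
    ∀ {j k} → gs ≤ j → j ≤ k → k ≤ ge →
    LongestLyndonPrefix α (suf (SA k)) → LongestLyndonPrefix α (suf (SA j))
  group-lyndonPrefix-antitone {α = α} sorted (_ , ge<n , _ , context) {j} {k} gs≤j j≤k k≤ge lyndon-k
    with m≤n⇒m<n∨m≡n j≤k
  ... | inj₂ refl = lyndon-k
  ... | inj₁ j<k  =
    subst (LongestLyndonPrefix α) (sym context-j)
      (longestLyndonPrefix-antitone α (subst₂ _≺_ context-j context-k (sorted j k j<k (≤-<-trans k≤ge ge<n)))
        (subst (LongestLyndonPrefix α) context-k lyndon-k))
    where
    context-j : suf (SA j) ≡ α ++ suf (SA j + length α)
    context-j = context j gs≤j (≤-trans j≤k k≤ge)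
    context-k : suf (SA k) ≡ α ++ suf (SA k + length α)
    context-k = context k (≤-trans gs≤j j≤k) k≤ge

  weaklyPreliminary-split : ∀ {gs ge α} → SortsSuffixes → Group gs ge α → WeaklyPreliminary gs ge α →
    ∃ λ g′ → gs ≤ g′ × g′ < ge × LyndonGroup gs g′ α × StronglyPreliminary (suc g′) ge α
  weaklyPreliminary-split {α = α} sorted group ((_ , ¬allLyndon) , someLyndon)
    with antitone-threshold (λ k → longestLyndonPrefix? α (suf (SA k)))
           (group-lyndonPrefix-antitone sorted group) someLyndon ¬allLyndon
  ... | g′ , gs≤g′ , g′<ge , lyndon , ¬lyndon =
    g′ , gs≤g′ , g′<ge ,
    (group-restrict group ≤-refl gs≤g′ (<⇒≤ g′<ge) , lyndon) ,
    ((group-restrict group (≤-trans gs≤g′ (n≤1+n g′)) g′<ge ≤-refl ,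
      λ allLyndon → ¬lyndon _ g′<ge ≤-refl (allLyndon _ g′<ge ≤-refl)) ,
     ¬lyndon)

  tiles-split : ∀ {p gs ge ℓ} pre post g′ → Tiles p (pre ++ (gs , ge , ℓ) ∷ post) →
    Tiles p (pre ++ (gs , g′ , ℓ) ∷ (suc g′ , ge , ℓ) ∷ post)
  tiles-split []                  post g′ (p≡gs , tiles) = p≡gs , refl , tiles
  tiles-split ((_ , _ , _) ∷ pre) post g′ (p≡gs , tiles) = p≡gs , tiles-split pre post g′ tiles

  suffixGrouping-split : ∀ {gs ge ℓ} pre post g′ → gs ≤ g′ → g′ < ge →
    SuffixGrouping (pre ++ (gs , ge , ℓ) ∷ post) →
    SuffixGrouping (pre ++ (gs , g′ , ℓ) ∷ (suc g′ , ge , ℓ) ∷ post)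
  suffixGrouping-split pre post g′ gs≤g′ g′<ge (_ , tiles , groups) with ++⁻ pre groups
  ... | groups-pre , (α , |α|≡ℓ , group) ∷ groups-post =
    nonEmpty pre , tiles-split pre post g′ tiles ,
    ++⁺ groups-pre ((α , |α|≡ℓ , group-restrict group ≤-refl gs≤g′ (<⇒≤ g′<ge)) ∷
                    (α , |α|≡ℓ , group-restrict group (≤-trans gs≤g′ (n≤1+n g′)) g′<ge ≤-refl) ∷
                    groups-post)
    where
    nonEmpty : ∀ pre {x y} → pre ++ x ∷ y ∷ post ≢ []
    nonEmpty []      ()
    nonEmpty (_ ∷ _) ()

lemma6 : {A : Set} (_<ₐ_ : A → A → Set) → IsStrictTotalOrder _≡_ _<ₐ_ →
    (S : List A) → Str.WellFormed _<ₐ_ S →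
    (SA : ℕ → ℕ) → Str.OnString.IsSuffixArray _<ₐ_ S SA →
    (pre post : List (ℕ × ℕ × ℕ)) (gs ge : ℕ) (α : List A) →
    Str.OnString.WithSA.SuffixGrouping _<ₐ_ S SA (pre ++ (gs , ge , length α) ∷ post) →
    Str.OnString.WithSA.Group _<ₐ_ S SA gs ge α →
    Str.OnString.WithSA.WeaklyPreliminary _<ₐ_ S SA gs ge α →
    ∃ λ g' → gs ≤ g' × g' < ge ×
      Str.OnString.WithSA.LyndonGroup _<ₐ_ S SA gs g' α ×
      Str.OnString.WithSA.StronglyPreliminary _<ₐ_ S SA (suc g') ge α ×
      Str.OnString.WithSA.SuffixGrouping _<ₐ_ S SA
        (pre ++ (gs , g' , length α) ∷ (suc g' , ge , length α) ∷ post)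
lemma6 _<ₐ_ sto S _ SA (_ , _ , sorted) pre post gs ge α grouping group weaklyPreliminary =
  let g′ , gs≤g′ , g′<ge , lyndonGroup , stronglyPreliminary =
        weaklyPreliminary-split sorted group weaklyPreliminary
  in g′ , gs≤g′ , g′<ge , lyndonGroup , stronglyPreliminary ,
     suffixGrouping-split pre post g′ gs≤g′ g′<ge grouping
  where open Groups _<ₐ_ sto S SA
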